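{- Let $G$ be a nonbipartite graph which $(\Delta,\beta,m)$-expands into $W\subseteq V(G)$, where $\Delta\ge 2$. Then $G$ contains an odd cycle $C$ with $|C|\le 16\log m+4|G|/(\beta m)$ such that $G$ $(\Delta-5,\beta,m)$-expands into $W\setminus V(C)$.
   Context: $\log$ is base 2; $|C|$ is the number of vertices of $C$; $m$ positive integer, $\beta>0$. $N_G(S)$ is the set of vertices adjacent to some vertex of $S$ and $N_W(S)=N_G(S)\cap W$. $G$ $(\Delta,\beta,m)$-expands into $W$ if (i) $|N_W(S)|\ge \Delta|S|$ for all $S\subseteq V(G)$ with $|S|<m$, and (ii) $|N_G(S)\cup S|\ge |S|+\beta m$ for all $S\subseteq V(G)$ with $m\le |S|\le |G|/2$.
   Formalization: The expansion parameters Δ and β are rational numbers. -}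

module Defs where

open import Data.Bool using (Bool; true; false; _∧_; _∨_; not)
open import Data.Nat as ℕ using (ℕ; zero; suc; _^_; _<_)
open import Data.Integer as ℤ using (ℤ; +_)
open import Data.Rational as ℚ using (ℚ; ↥_; ↧ₙ_; _/_)
open import Data.Fin using (Fin; zero; suc; _≟_; toℕ; fromℕ<)
open import Data.Nat.DivMod using (m%n<n)
open import Data.Fin.Subset using (Subset; _∩_; _∪_; ∁; ∣_∣)
open import Data.Vec using (Vec; lookup; tabulate)
open import Data.Product using (Σ; ∃; _×_; _,_)
open import Data.Sum using (_⊎_)
open import Function using (_∘_)
open import Function.Definitions using (Injective)
open import Relation.Nullary using (¬_; does)
open import Relation.Binary.PropositionalEquality using (_≡_; _≢_)

record Graph (n : ℕ) : Set where
  field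
    adj    : Fin n → Fin n → Bool
    sym    : ∀ u v → adj u v ≡ adj v u
    irrefl : ∀ v → adj v v ≡ false
open Graph public

anyFin : ∀ {n} → (Fin n → Bool) → Bool
anyFin {zero}  f = false
anyFin {suc n} f = f zero ∨ anyFin (f ∘ suc)

⟦_⟧ : ℕ → ℚ
⟦ k ⟧ = + k / 1

N : ∀ {n} → Graph n → Subset n → Subset n
N G S = tabulate λ v → anyFin λ u → lookup S u ∧ adj G u v

Expands : ∀ {n} → Graph n → (Δ β : ℚ) (m : ℕ) → Subset n → Set
Expands {n} G Δ β m W =
  (∀ (S : Subset n) → ∣ S ∣ < m → Δ ℚ.* ⟦ ∣ S ∣ ⟧ ℚ.≤ ⟦ ∣ N G S ∩ W ∣ ⟧)
  × (∀ (S : Subset n) → m ℕ.≤ ∣ S ∣ → 2 ℕ.* ∣ S ∣ ℕ.≤ n →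
       ⟦ ∣ S ∣ ⟧ ℚ.+ β ℚ.* ⟦ m ⟧ ℚ.≤ ⟦ ∣ N G S ∪ S ∣ ⟧)

Bipartite : ∀ {n} → Graph n → Set
Bipartite {n} G = Σ (Fin n → Bool) λ c → ∀ u v → adj G u v ≡ true → c u ≢ c v

next : ∀ {k} → Fin k → Fin k
next {suc k} i = fromℕ< (m%n<n (toℕ i ℕ.+ 1) (suc k))

record Cycle {n} (G : Graph n) (k : ℕ) : Set where
  field
    vtx      : Vec (Fin n) k
    long     : 3 ℕ.≤ k
    distinct : Injective _≡_ _≡_ (lookup vtx)
    edges    : ∀ i → adj G (lookup vtx i) (lookup vtx (next i)) ≡ true
open Cycle public

Odd : ℕ → Set
Odd k = ∃ λ j → k ≡ suc (2 ℕ.* j)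

V : ∀ {n k} {G : Graph n} → Cycle G k → Subset n
V C = tabulate λ v → anyFin λ i → does (lookup (vtx C) i ≟ v)

-- q ≤ log₂ m  (for m ≥ 1): either q ≤ 0, or q = p/d with p > 0 and 2^p ≤ m^d
_≤log₂_ : ℚ → ℕ → Set
q ≤log₂ m = (↥ q ℤ.≤ + 0) ⊎ (2 ^ ℤ.∣ ↥ q ∣ ℕ.≤ m ^ (↧ₙ q))

-- k ≤ 16 log₂ m + 4 n / (β m), phrased with x := 4n/(βm) characterised by x·(βm) = 4n
CycleBound : (k m n : ℕ) (β : ℚ) → Set
CycleBound k m n β = ∀ (x : ℚ) → x ℚ.* (β ℚ.* ⟦ m ⟧) ≡ ⟦ 4 ℕ.* n ⟧ →
  ((⟦ k ⟧ ℚ.- x) ℚ.* (+ 1 / 16)) ≤log₂ m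

{-# OPTIONS --safe #-}

module Submission where

-- Take a shortest odd closed walk C, of length k = 2h + 1 (it exists: expansion makes G
-- connected, and then a 2-colouring by the parity of walks from a fixed vertex fails somewhere).
-- C has no shortcuts: a walk between two of its vertices is at least as long as the arc of C it
-- replaces, or else it closes an odd walk of length at least k together with that arc. Hence C is a
-- cycle, every vertex has at most five neighbours on C (so S loses at most 5|S| neighbours when V(C) is
-- removed from W), and the balls of radii r, r' around the opposite vertices C₀ and C_h are disjoint
-- when r + r' < h. A ball doubles while it has fewer than m vertices (Δ ≥ 2) and then gains βm
-- vertices per step until it exceeds n/2, so 2m + (h - 1 - 2a)βm ≤ n once m ≤ 2^a, i.e.
-- k ≤ 4a + 3 + 4n/(βm) ≤ 16 log m + 4n/(βm) for a = ⌈log m⌉ ≥ 1. For m = 1 the logarithm vanishes and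
-- the constant is absorbed by the neighbourhoods of C₀ and C₁: each has at least β vertices, and they
-- are disjoint when k ≥ 5.

open import Defs hiding (sym)
open import Data.Bool using (Bool; true; false; _∧_)
import Data.Bool.Properties as Boolₚ
open import Data.Empty using (⊥-elim)
open import Data.Fin using (Fin; zero; suc; toℕ)
import Data.Fin.Properties as Finₚ
open import Data.Fin.Subset using (Subset; _∈_; _∉_; _⊆_; _∪_; _∩_; ∁; ⁅_⁆; ∣_∣; ⊥; ⋃)
open import Data.Fin.Subset.Properties
  using (∣p∣≤n; ∣⊥∣≡0; ∣⁅x⁆∣≡1; ∣∁p∣≡n∸∣p∣; p⊆q⇒∣p∣≤∣q∣; q⊆p∪q; x∈⁅x⁆; x∈⁅y⁆⇒x≡y;
         x∈p∪q⁺; x∈p∪q⁻; x∈p∩q⁺; x∈p∩q⁻; x∉p⇒x∈∁p; _∈?_)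
import Data.Integer as ℤ
import Data.Integer.Properties as ℤₚ
open import Data.List using (List; []; _∷_; map; length)
open import Data.List.Membership.Propositional using () renaming (_∈_ to _∈ₗ_)
open import Data.List.Membership.Propositional.Properties using (∈-map⁺)
open import Data.List.Relation.Unary.Any using (here; there)
open import Data.Nat as ℕ
  using (ℕ; zero; suc; _+_; _*_; _∸_; _^_; _≤_; _<_; _≤?_; _<?_; z≤n; s≤s; s≤s⁻¹; NonZero;
         _≤′_; ≤′-refl; ≤′-step; parity)
open import Data.Nat.Coprimality as Coprimality using (1-coprimeTo)
open import Data.Nat.DivMod using (_%_; m<n⇒m%n≡m; n%n≡0; m%n<n)
open import Data.Nat.Induction using (<-rec)
open import Data.Nat.Properties
open import Data.Nat.Tactic.RingSolver using (solve-∀)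
open import Data.Parity.Base as ℙ using (Parity; 0ℙ; 1ℙ)
import Data.Parity.Properties as ℙₚ
open import Data.Product using (Σ; ∃-syntax; _×_; _,_; proj₁; proj₂)
open import Data.Rational as ℚ using (ℚ; mkℚ; 0ℚ; _/_)
import Data.Rational.Properties as ℚₚ
open import Data.Rational.Solver using (module +-*-Solver)
import Data.Rational.Unnormalised as ℚᵘ
import Data.Rational.Unnormalised.Properties as ℚᵘₚ
open import Data.Sum using (_⊎_; inj₁; inj₂; [_,_]′)
open import Data.Vec using ([]; _∷_; lookup; tabulate; here; there)
open import Data.Vec.Properties using (lookup∘tabulate; []=⇒lookup; lookup⇒[]=)
open import Function using (_∘_; id)
open import Relation.Binary.Definitions using (tri<; tri≈; tri>)
open import Relation.Binary.PropositionalEquality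
open import Relation.Nullary using (Dec; yes; no; ¬_)
open import Relation.Nullary.Decidable using (_×-dec_)
open import Relation.Unary using (Pred; Decidable)

-- Counting subsets

∣p∪q∣≤∣p∣+∣q∣ : ∀ {n} (p q : Subset n) → ∣ p ∪ q ∣ ≤ ∣ p ∣ + ∣ q ∣
∣p∪q∣≤∣p∣+∣q∣ []          []          = z≤n
∣p∪q∣≤∣p∣+∣q∣ (false ∷ p) (false ∷ q) = ∣p∪q∣≤∣p∣+∣q∣ p q
∣p∪q∣≤∣p∣+∣q∣ (false ∷ p) (true  ∷ q) = ≤-trans (s≤s (∣p∪q∣≤∣p∣+∣q∣ p q)) (≤-reflexive (sym (+-suc ∣ p ∣ ∣ q ∣)))
∣p∪q∣≤∣p∣+∣q∣ (true  ∷ p) (false ∷ q) = s≤s (∣p∪q∣≤∣p∣+∣q∣ p q)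
∣p∪q∣≤∣p∣+∣q∣ (true  ∷ p) (true  ∷ q) = s≤s (≤-trans (∣p∪q∣≤∣p∣+∣q∣ p q) (+-monoʳ-≤ ∣ p ∣ (n≤1+n ∣ q ∣)))

disjoint⇒∣p∣+∣q∣≤n : ∀ {n} (p q : Subset n) → (∀ {x} → x ∈ p → x ∉ q) → ∣ p ∣ + ∣ q ∣ ≤ n
disjoint⇒∣p∣+∣q∣≤n {n} p q disjoint = begin
  ∣ p ∣ + ∣ q ∣ ≡⟨ +-comm ∣ p ∣ ∣ q ∣ ⟩
  ∣ q ∣ + ∣ p ∣ ≤⟨ m≤o∸n⇒m+n≤o ∣ q ∣ (∣p∣≤n p) ∣q∣≤n∸∣p∣ ⟩
  n             ∎
  where
  open ≤-Reasoning
  ∣q∣≤n∸∣p∣ : ∣ q ∣ ≤ n ∸ ∣ p ∣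
  ∣q∣≤n∸∣p∣ = ≤-trans (p⊆q⇒∣p∣≤∣q∣ (λ x∈q → x∉p⇒x∈∁p (λ x∈p → disjoint x∈p x∈q)))
                      (≤-reflexive (∣∁p∣≡n∸∣p∣ p))

⋃[_]_ : ∀ {m n} → Subset m → (Fin m → Subset n) → Subset n
⋃[ [] ]        F = ⊥
⋃[ true ∷ S ]  F = F zero ∪ ⋃[ S ] (F ∘ suc)
⋃[ false ∷ S ] F = ⋃[ S ] (F ∘ suc)

∣⋃[S]F∣≤c*∣S∣ : ∀ {m n} c (S : Subset m) (F : Fin m → Subset n) →
                (∀ i → ∣ F i ∣ ≤ c) → ∣ ⋃[ S ] F ∣ ≤ c * ∣ S ∣
∣⋃[S]F∣≤c*∣S∣ {n = n} c [] F _ = ≤-trans (≤-reflexive (∣⊥∣≡0 n)) z≤n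
∣⋃[S]F∣≤c*∣S∣ c (true ∷ S) F ∣F∣≤c = begin
  ∣ F zero ∪ ⋃[ S ] (F ∘ suc) ∣     ≤⟨ ∣p∪q∣≤∣p∣+∣q∣ (F zero) _ ⟩
  ∣ F zero ∣ + ∣ ⋃[ S ] (F ∘ suc) ∣ ≤⟨ +-mono-≤ (∣F∣≤c zero) (∣⋃[S]F∣≤c*∣S∣ c S (F ∘ suc) (∣F∣≤c ∘ suc)) ⟩
  c + c * ∣ S ∣                     ≡⟨ *-suc c ∣ S ∣ ⟨
  c * suc ∣ S ∣                     ∎
  where open ≤-Reasoning
∣⋃[S]F∣≤c*∣S∣ c (false ∷ S) F ∣F∣≤c = ∣⋃[S]F∣≤c*∣S∣ c S (F ∘ suc) (∣F∣≤c ∘ suc)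

x∈⋃[S]F⁺ : ∀ {m n} (S : Subset m) (F : Fin m → Subset n) {i x} → i ∈ S → x ∈ F i → x ∈ ⋃[ S ] F
x∈⋃[S]F⁺ (true ∷ S)  F here         x∈Fi = x∈p∪q⁺ (inj₁ x∈Fi)
x∈⋃[S]F⁺ (true ∷ S)  F (there i∈S)  x∈Fi = x∈p∪q⁺ (inj₂ (x∈⋃[S]F⁺ S (F ∘ suc) i∈S x∈Fi))
x∈⋃[S]F⁺ (false ∷ S) F (there i∈S)  x∈Fi = x∈⋃[S]F⁺ S (F ∘ suc) i∈S x∈Fi

fromList : ∀ {n} → List (Fin n) → Subset n
fromList xs = ⋃ (map ⁅_⁆ xs)

∣fromList∣≤length : ∀ {n} (xs : List (Fin n)) → ∣ fromList xs ∣ ≤ length xs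
∣fromList∣≤length {n} []       = ≤-reflexive (∣⊥∣≡0 n)
∣fromList∣≤length      (x ∷ xs) = begin
  ∣ ⁅ x ⁆ ∪ fromList xs ∣     ≤⟨ ∣p∪q∣≤∣p∣+∣q∣ ⁅ x ⁆ (fromList xs) ⟩
  ∣ ⁅ x ⁆ ∣ + ∣ fromList xs ∣ ≡⟨ cong (_+ ∣ fromList xs ∣) (∣⁅x⁆∣≡1 x) ⟩
  suc ∣ fromList xs ∣         ≤⟨ s≤s (∣fromList∣≤length xs) ⟩
  suc (length xs)             ∎
  where open ≤-Reasoning

x∈fromList⁺ : ∀ {n} {x : Fin n} {xs} → x ∈ₗ xs → x ∈ fromList xs
x∈fromList⁺ (here refl) = x∈p∪q⁺ (inj₁ (x∈⁅x⁆ _))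
x∈fromList⁺ (there x∈xs) = x∈p∪q⁺ (inj₂ (x∈fromList⁺ x∈xs))

-- Arithmetic

m+n≤o∧o<2n⇒2m≤o : ∀ m n {o} → m + n ≤ o → o < 2 * n → 2 * m ≤ o
m+n≤o∧o<2n⇒2m≤o m n {o} m+n≤o o<2n = <⇒≤ (+-cancelʳ-< o (2 * m) o (begin-strict
  2 * m + o       <⟨ +-monoʳ-< (2 * m) o<2n ⟩
  2 * m + 2 * n   ≡⟨ *-distribˡ-+ 2 m n ⟨
  2 * (m + n)     ≤⟨ *-monoʳ-≤ 2 m+n≤o ⟩
  2 * o           ≡⟨ cong (_+_ o) (+-identityʳ o) ⟩
  o + o           ∎))
  where open ≤-Reasoning

2^≤^-rescale : ∀ {p e c D m} .{{_ : NonZero D}} → p * D ≤ c * e → 2 ^ c ≤ m ^ D → 2 ^ p ≤ m ^ e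
2^≤^-rescale {p} {e} {c} {D} {m} pD≤ce 2^c≤m^D = ≮⇒≥ λ m^e<2^p → <-irrefl refl (begin-strict
  (m ^ e) ^ D   <⟨ ^-monoˡ-< D m^e<2^p ⟩
  (2 ^ p) ^ D   ≡⟨ ^-*-assoc 2 p D ⟩
  2 ^ (p * D)   ≤⟨ ^-monoʳ-≤ 2 pD≤ce ⟩
  2 ^ (c * e)   ≡⟨ ^-*-assoc 2 c e ⟨
  (2 ^ c) ^ e   ≤⟨ ^-monoˡ-≤ e 2^c≤m^D ⟩
  (m ^ D) ^ e   ≡⟨ ^-*-assoc m D e ⟩
  m ^ (D * e)   ≡⟨ cong (m ^_) (*-comm D e) ⟩
  m ^ (e * D)   ≡⟨ ^-*-assoc m e D ⟨
  (m ^ e) ^ D   ∎)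
  where open ≤-Reasoning

power-of-2-between : ∀ m → 1 ≤ m → ∃[ a ] m ≤ 2 ^ a × 2 ^ a < 2 * m
power-of-2-between 1 _ = 0 , ≤-refl , s≤s (s≤s z≤n)
power-of-2-between (suc (suc m)) _ with a , 1+m≤2^a , 2^a<2[1+m] ← power-of-2-between (suc m) (s≤s z≤n)
                                   with suc (suc m) ≤? 2 ^ a
... | yes 2+m≤2^a = a , 2+m≤2^a , <-≤-trans 2^a<2[1+m] (*-monoʳ-≤ 2 (n≤1+n (suc m)))
... | no  2+m≰2^a = suc a , 2+m≤2^[1+a] , *-monoʳ-< 2 (≰⇒> 2+m≰2^a)
  where
  2+m≤2^[1+a] : 2 + m ≤ 2 * 2 ^ a
  2+m≤2^[1+a] = begin
    1 + suc m        ≤⟨ +-monoˡ-≤ (suc m) (s≤s z≤n) ⟩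
    suc m + suc m    ≡⟨ cong (_+_ (suc m)) (+-identityʳ (suc m)) ⟨
    2 * suc m        ≤⟨ *-monoʳ-≤ 2 1+m≤2^a ⟩
    2 * 2 ^ a        ∎
    where open ≤-Reasoning

2^[4a+3]≤m^16 : ∀ {a m} → 1 ≤ a → 2 ^ a ≤ m ^ 2 → 2 ^ (4 * a + 3) ≤ m ^ 16
2^[4a+3]≤m^16 {a} {m} 1≤a = 2^≤^-rescale {4 * a + 3} {16} {a} {2} {m} (begin
  (4 * a + 3) * 2   ≡⟨ expand a ⟩
  8 * a + 6         ≤⟨ +-monoʳ-≤ (8 * a) (≤-trans (≤ᵇ⇒≤ 6 8 _) (*-monoʳ-≤ 8 1≤a)) ⟩
  8 * a + 8 * a     ≡⟨ collect a ⟩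
  a * 16            ∎)
  where
  open ≤-Reasoning
  expand : ∀ a → (4 * a + 3) * 2 ≡ 8 * a + 6
  expand = solve-∀
  collect : ∀ a → 8 * a + 8 * a ≡ a * 16
  collect = solve-∀

least : ∀ {p} {P : Pred ℕ p} → Decidable P → ∀ {ℓ} → P ℓ → ∃[ k ] P k × (∀ {j} → j < k → ¬ P j)
least {P = P} P? = <-rec (λ ℓ → P ℓ → ∃[ k ] P k × (∀ {j} → j < k → ¬ P j)) search _
  where
  search : ∀ ℓ → (∀ {j} → j < ℓ → P j → ∃[ k ] P k × (∀ {i} → i < k → ¬ P i)) →
           P ℓ → ∃[ k ] P k × (∀ {j} → j < k → ¬ P j)
  search ℓ below Pℓ with anyUpTo? P? ℓ
  ... | yes (j , j<ℓ , Pj) = below j<ℓ Pj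
  ... | no  none           = ℓ , Pℓ , λ j<ℓ Pj → none (_ , j<ℓ , Pj)

-- Natural numbers as rationals

⟦⟧≡mkℚ : ∀ a → ⟦ a ⟧ ≡ mkℚ (ℤ.+ a) 0 (Coprimality.sym (1-coprimeTo a))
⟦⟧≡mkℚ a = ℚₚ.normalize-coprime (Coprimality.sym (1-coprimeTo a))

⟦⟧-mono-≤ : ∀ {a b} → a ≤ b → ⟦ a ⟧ ℚ.≤ ⟦ b ⟧
⟦⟧-mono-≤ {a} {b} a≤b rewrite ⟦⟧≡mkℚ a | ⟦⟧≡mkℚ b =
  ℚ.*≤* (subst₂ ℤ._≤_ (sym (ℤₚ.*-identityʳ (ℤ.+ a))) (sym (ℤₚ.*-identityʳ (ℤ.+ b))) (ℤ.+≤+ a≤b))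

⟦⟧-cancel-≤ : ∀ {a b} → ⟦ a ⟧ ℚ.≤ ⟦ b ⟧ → a ≤ b
⟦⟧-cancel-≤ {a} {b} ⟦a⟧≤⟦b⟧ rewrite ⟦⟧≡mkℚ a | ⟦⟧≡mkℚ b with ⟦a⟧≤⟦b⟧
... | ℚ.*≤* a*1≤b*1 with subst₂ ℤ._≤_ (ℤₚ.*-identityʳ (ℤ.+ a)) (ℤₚ.*-identityʳ (ℤ.+ b)) a*1≤b*1
...   | ℤ.+≤+ a≤b = a≤b

⟦⟧-homo-+ : ∀ a b → ⟦ a + b ⟧ ≡ ⟦ a ⟧ ℚ.+ ⟦ b ⟧
⟦⟧-homo-+ a b rewrite ⟦⟧≡mkℚ a | ⟦⟧≡mkℚ b | ℤₚ.*-identityʳ (ℤ.+ a) | ℤₚ.*-identityʳ (ℤ.+ b) = refl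

⟦⟧-homo-* : ∀ a b → ⟦ a * b ⟧ ≡ ⟦ a ⟧ ℚ.* ⟦ b ⟧
⟦⟧-homo-* a b rewrite ⟦⟧≡mkℚ a | ⟦⟧≡mkℚ b | sym (ℤₚ.pos-* a b) = refl

⟦⟧-nonNeg : ∀ a → ℚ.NonNegative ⟦ a ⟧
⟦⟧-nonNeg a = ℚ.nonNegative (⟦⟧-mono-≤ {0} {a} z≤n)

⟦⟧-pos : ∀ a → .{{NonZero a}} → ℚ.Positive ⟦ a ⟧
⟦⟧-pos (suc a) = ℚ.positive (ℚₚ.<-≤-trans (ℚ.*<* (ℤ.+<+ (s≤s z≤n))) (⟦⟧-mono-≤ {1} {suc a} (s≤s z≤n)))

ℚ+-cancelˡ-≤ : ∀ r {p q} → r ℚ.+ p ℚ.≤ r ℚ.+ q → p ℚ.≤ q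
ℚ+-cancelˡ-≤ r {p} {q} r+p≤r+q = begin
  p                      ≡⟨ solve 2 (λ R P → P := (:- R) :+ (R :+ P)) refl r p ⟩
  ℚ.- r ℚ.+ (r ℚ.+ p)    ≤⟨ ℚₚ.+-monoʳ-≤ (ℚ.- r) r+p≤r+q ⟩
  ℚ.- r ℚ.+ (r ℚ.+ q)    ≡⟨ solve 2 (λ R Q → (:- R) :+ (R :+ Q) := Q) refl r q ⟩
  q                      ∎
  where
  open ℚₚ.≤-Reasoning
  open +-*-Solver using (solve; _:+_; :-_; _:=_)

≤log₂-intro : ∀ q D c m .{{_ : NonZero D}} → q ℚ.* ⟦ D ⟧ ℚ.≤ ⟦ c ⟧ → 2 ^ c ≤ m ^ D → q ≤log₂ m
≤log₂-intro (mkℚ (ℤ.+ zero)   _ _) D c m _ _ = inj₁ (ℤ.+≤+ z≤n)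
≤log₂-intro (mkℚ ℤ.-[1+ _ ]   _ _) D c m _ _ = inj₁ ℤ.-≤+
≤log₂-intro q@(mkℚ (ℤ.+ suc p) d _) D c m qD≤c 2^c≤m^D =
  inj₂ (2^≤^-rescale {suc p} {suc d} {c} {D} {m} ↥q*D≤c*↧q 2^c≤m^D)
  where
  qDᵘ≤cᵘ : ℚ.toℚᵘ q ℚᵘ.* ℚ.toℚᵘ ⟦ D ⟧ ℚᵘ.≤ ℚ.toℚᵘ ⟦ c ⟧
  qDᵘ≤cᵘ = ℚᵘₚ.≤-respˡ-≃ (ℚₚ.toℚᵘ-homo-* q ⟦ D ⟧) (ℚₚ.toℚᵘ-mono-≤ qD≤c)
  ↥q*D≤c*↧q : suc p * D ≤ c * suc d
  ↥q*D≤c*↧q with ⟦ D ⟧ | ⟦⟧≡mkℚ D | ⟦ c ⟧ | ⟦⟧≡mkℚ c | qDᵘ≤cᵘ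
  ... | _ | refl | _ | refl | ℚᵘ.*≤* le
    with ℤ.+≤+ le′ ← subst₂ ℤ._≤_
           (trans (ℤₚ.*-identityʳ _) (sym (ℤₚ.pos-* (suc p) D)))
           (trans (cong (λ e → ℤ.+ c ℤ.* ℤ.+ e) (*-identityʳ (suc d))) (sym (ℤₚ.pos-* c (suc d))))
           le
    = le′

⟦c⟧≤Δ⇒c*s≤t : ∀ {Δ} c {s t} → ⟦ c ⟧ ℚ.≤ Δ → Δ ℚ.* ⟦ s ⟧ ℚ.≤ ⟦ t ⟧ → c * s ≤ t
⟦c⟧≤Δ⇒c*s≤t {Δ} c {s} {t} c≤Δ Δs≤t = ⟦⟧-cancel-≤ (begin
  ⟦ c * s ⟧         ≡⟨ ⟦⟧-homo-* c s ⟩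
  ⟦ c ⟧ ℚ.* ⟦ s ⟧   ≤⟨ ℚₚ.*-monoʳ-≤-nonNeg ⟦ s ⟧ {{⟦⟧-nonNeg s}} c≤Δ ⟩
  Δ ℚ.* ⟦ s ⟧       ≤⟨ Δs≤t ⟩
  ⟦ t ⟧             ∎)
  where open ℚₚ.≤-Reasoning

Δ*s≤t+c*s⇒[Δ-c]*s≤t : ∀ Δ c s t → Δ ℚ.* ⟦ s ⟧ ℚ.≤ ⟦ t + c * s ⟧ → (Δ ℚ.- ⟦ c ⟧) ℚ.* ⟦ s ⟧ ℚ.≤ ⟦ t ⟧
Δ*s≤t+c*s⇒[Δ-c]*s≤t Δ c s t Δs≤t+cs = begin
  (Δ ℚ.- ⟦ c ⟧) ℚ.* ⟦ s ⟧
    ≡⟨ solve 3 (λ D C S → (D :- C) :* S := D :* S :- C :* S) refl Δ ⟦ c ⟧ ⟦ s ⟧ ⟩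
  Δ ℚ.* ⟦ s ⟧ ℚ.- ⟦ c ⟧ ℚ.* ⟦ s ⟧
    ≤⟨ ℚₚ.+-monoˡ-≤ (ℚ.- (⟦ c ⟧ ℚ.* ⟦ s ⟧)) Δs≤t+cs ⟩
  ⟦ t + c * s ⟧ ℚ.- ⟦ c ⟧ ℚ.* ⟦ s ⟧
    ≡⟨ cong (ℚ._- ⟦ c ⟧ ℚ.* ⟦ s ⟧) (trans (⟦⟧-homo-+ t (c * s)) (cong (⟦ t ⟧ ℚ.+_) (⟦⟧-homo-* c s))) ⟩
  ⟦ t ⟧ ℚ.+ ⟦ c ⟧ ℚ.* ⟦ s ⟧ ℚ.- ⟦ c ⟧ ℚ.* ⟦ s ⟧
    ≡⟨ solve 3 (λ T C S → T :+ C :* S :- C :* S := T) refl ⟦ t ⟧ ⟦ c ⟧ ⟦ s ⟧ ⟩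
  ⟦ t ⟧
    ∎
  where
  open ℚₚ.≤-Reasoning
  open +-*-Solver using (solve; _:+_; _:*_; _:-_; _:=_)

β*⟦m⟧-pos : ∀ {β m} → 1 ≤ m → 0ℚ ℚ.< β → 0ℚ ℚ.< β ℚ.* ⟦ m ⟧
β*⟦m⟧-pos {β} {suc m} _ β>0 =
  subst (ℚ._< β ℚ.* ⟦ suc m ⟧) (ℚₚ.*-zeroˡ ⟦ suc m ⟧) (ℚₚ.*-monoˡ-<-pos ⟦ suc m ⟧ {{⟦⟧-pos (suc m)}} β>0)

-- Growth by steps of a fixed rational

module Steps (b : ℚ) (b>0 : 0ℚ ℚ.< b) where

  open +-*-Solver using (solve; _:+_; _:*_; _:=_)

  -- A record rather than a definition, so that p, j and q can be inferred.
  infix 4 _+[_]≤_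
  record _+[_]≤_ (p j q : ℕ) : Set where
    constructor +[]≤⁺
    field +[]≤⁻ : ⟦ p ⟧ ℚ.+ ⟦ j ⟧ ℚ.* b ℚ.≤ ⟦ q ⟧

  private instance
    b-pos : ℚ.Positive b
    b-pos = ℚ.positive b>0

  ⟦j⟧*b-nonNeg : ∀ j → 0ℚ ℚ.≤ ⟦ j ⟧ ℚ.* b
  ⟦j⟧*b-nonNeg j = ℚₚ.≤-trans (ℚₚ.≤-reflexive (sym (ℚₚ.*-zeroˡ b)))
                              (ℚₚ.*-monoʳ-≤-nonNeg b {{ℚₚ.pos⇒nonNeg b}} (⟦⟧-mono-≤ {0} {j} z≤n))

  +[0]≤ : ∀ {p q} → p ≤ q → p +[ 0 ]≤ q
  +[0]≤ {p} p≤q = +[]≤⁺ (ℚₚ.≤-trans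
    (ℚₚ.≤-reflexive (trans (cong (⟦ p ⟧ ℚ.+_) (ℚₚ.*-zeroˡ b)) (ℚₚ.+-identityʳ ⟦ p ⟧)))
    (⟦⟧-mono-≤ p≤q))

  +[1]≤-intro : ∀ {p q} → ⟦ p ⟧ ℚ.+ b ℚ.≤ ⟦ q ⟧ → p +[ 1 ]≤ q
  +[1]≤-intro {p} p+b≤q = +[]≤⁺ (ℚₚ.≤-trans (ℚₚ.≤-reflexive (cong (⟦ p ⟧ ℚ.+_) (ℚₚ.*-identityˡ b))) p+b≤q)

  +[]≤⇒≤ : ∀ {p j q} → p +[ j ]≤ q → p ≤ q
  +[]≤⇒≤ {p} {j} (+[]≤⁺ p+jb≤q) = ⟦⟧-cancel-≤ (ℚₚ.≤-trans
    (ℚₚ.≤-trans (ℚₚ.≤-reflexive (sym (ℚₚ.+-identityʳ ⟦ p ⟧))) (ℚₚ.+-monoʳ-≤ ⟦ p ⟧ (⟦j⟧*b-nonNeg j)))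
    p+jb≤q)

  +[1+j]≤⇒< : ∀ {p j q} → p +[ suc j ]≤ q → p < q
  +[1+j]≤⇒< {p} {j} (+[]≤⁺ p+jb≤q) =
    ≰⇒> λ q≤p → ℚₚ.<-irrefl refl (ℚₚ.<-≤-trans p<p+jb (ℚₚ.≤-trans p+jb≤q (⟦⟧-mono-≤ q≤p)))
    where
    p<p+jb : ⟦ p ⟧ ℚ.< ⟦ p ⟧ ℚ.+ ⟦ suc j ⟧ ℚ.* b
    p<p+jb = subst (ℚ._< ⟦ p ⟧ ℚ.+ ⟦ suc j ⟧ ℚ.* b) (ℚₚ.+-identityʳ ⟦ p ⟧)
      (ℚₚ.+-monoʳ-< ⟦ p ⟧ (subst (ℚ._< ⟦ suc j ⟧ ℚ.* b) (ℚₚ.*-zeroˡ b)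
        (ℚₚ.*-monoˡ-<-pos b (ℚₚ.positive⁻¹ ⟦ suc j ⟧ {{⟦⟧-pos (suc j)}}))))

  +[]≤-monoʲ : ∀ {p i j q} → i ≤ j → p +[ j ]≤ q → p +[ i ]≤ q
  +[]≤-monoʲ {p} i≤j (+[]≤⁺ p+jb≤q) = +[]≤⁺ (ℚₚ.≤-trans
    (ℚₚ.+-monoʳ-≤ ⟦ p ⟧ (ℚₚ.*-monoʳ-≤-nonNeg b {{ℚₚ.pos⇒nonNeg b}} (⟦⟧-mono-≤ i≤j)))
    p+jb≤q)

  +[]≤-weakenʳ : ∀ {p j q r} → q ≤ r → p +[ j ]≤ q → p +[ j ]≤ r
  +[]≤-weakenʳ q≤r (+[]≤⁺ p+jb≤q) = +[]≤⁺ (ℚₚ.≤-trans p+jb≤q (⟦⟧-mono-≤ q≤r))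

  +[]≤-trans : ∀ {p i q j r} → p +[ i ]≤ q → q +[ j ]≤ r → p +[ i + j ]≤ r
  +[]≤-trans {p} {i} {q} {j} {r} (+[]≤⁺ p+ib≤q) (+[]≤⁺ q+jb≤r) = +[]≤⁺ (begin
    ⟦ p ⟧ ℚ.+ ⟦ i + j ⟧ ℚ.* b                 ≡⟨ cong (λ x → ⟦ p ⟧ ℚ.+ x ℚ.* b) (⟦⟧-homo-+ i j) ⟩
    ⟦ p ⟧ ℚ.+ (⟦ i ⟧ ℚ.+ ⟦ j ⟧) ℚ.* b         ≡⟨ solve 4 (λ P I J B → P :+ (I :+ J) :* B := (P :+ I :* B) :+ J :* B)
                                                        refl ⟦ p ⟧ ⟦ i ⟧ ⟦ j ⟧ b ⟩
    (⟦ p ⟧ ℚ.+ ⟦ i ⟧ ℚ.* b) ℚ.+ ⟦ j ⟧ ℚ.* b   ≤⟨ ℚₚ.+-monoˡ-≤ (⟦ j ⟧ ℚ.* b) p+ib≤q ⟩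
    ⟦ q ⟧ ℚ.+ ⟦ j ⟧ ℚ.* b                     ≤⟨ q+jb≤r ⟩
    ⟦ r ⟧                                     ∎)
    where open ℚₚ.≤-Reasoning

  +[]≤-+ : ∀ {p i q p′ j q′} → p +[ i ]≤ q → p′ +[ j ]≤ q′ → p + p′ +[ i + j ]≤ q + q′
  +[]≤-+ {p} {i} {q} {p′} {j} {q′} (+[]≤⁺ p+ib≤q) (+[]≤⁺ p′+jb≤q′) = +[]≤⁺ (begin
    ⟦ p + p′ ⟧ ℚ.+ ⟦ i + j ⟧ ℚ.* b
      ≡⟨ cong₂ (λ x y → x ℚ.+ y ℚ.* b) (⟦⟧-homo-+ p p′) (⟦⟧-homo-+ i j) ⟩
    (⟦ p ⟧ ℚ.+ ⟦ p′ ⟧) ℚ.+ (⟦ i ⟧ ℚ.+ ⟦ j ⟧) ℚ.* b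
      ≡⟨ solve 5 (λ P P′ I J B → (P :+ P′) :+ (I :+ J) :* B := (P :+ I :* B) :+ (P′ :+ J :* B))
                 refl ⟦ p ⟧ ⟦ p′ ⟧ ⟦ i ⟧ ⟦ j ⟧ b ⟩
    (⟦ p ⟧ ℚ.+ ⟦ i ⟧ ℚ.* b) ℚ.+ (⟦ p′ ⟧ ℚ.+ ⟦ j ⟧ ℚ.* b)
      ≤⟨ ℚₚ.+-mono-≤ p+ib≤q p′+jb≤q′ ⟩
    ⟦ q ⟧ ℚ.+ ⟦ q′ ⟧
      ≡⟨ ⟦⟧-homo-+ q q′ ⟨
    ⟦ q + q′ ⟧
      ∎)
    where open ℚₚ.≤-Reasoning

  +[]≤-scale : ∀ c {j q} → 0 +[ j ]≤ q → 0 +[ c * j ]≤ c * q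
  +[]≤-scale zero    _      = +[0]≤ z≤n
  +[]≤-scale (suc c) 0+jb≤q = +[]≤-+ 0+jb≤q (+[]≤-scale c 0+jb≤q)

  +[]≤-cancelˡ : ∀ {p r j q} → r + p +[ j ]≤ r + q → p +[ j ]≤ q
  +[]≤-cancelˡ {p} {r} {j} {q} (+[]≤⁺ r+p+jb≤r+q) = +[]≤⁺ (ℚ+-cancelˡ-≤ ⟦ r ⟧ (begin
    ⟦ r ⟧ ℚ.+ (⟦ p ⟧ ℚ.+ ⟦ j ⟧ ℚ.* b)  ≡⟨ ℚₚ.+-assoc ⟦ r ⟧ ⟦ p ⟧ _ ⟨
    (⟦ r ⟧ ℚ.+ ⟦ p ⟧) ℚ.+ ⟦ j ⟧ ℚ.* b  ≡⟨ cong (ℚ._+ ⟦ j ⟧ ℚ.* b) (⟦⟧-homo-+ r p) ⟨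
    ⟦ r + p ⟧ ℚ.+ ⟦ j ⟧ ℚ.* b          ≤⟨ r+p+jb≤r+q ⟩
    ⟦ r + q ⟧                          ≡⟨ ⟦⟧-homo-+ r q ⟩
    ⟦ r ⟧ ℚ.+ ⟦ q ⟧                    ∎))
    where open ℚₚ.≤-Reasoning

module Growth (b : ℚ) (b>0 : 0ℚ ℚ.< b) where

  open Steps b b>0

  record Expanding (n m : ℕ) (s : ℕ → ℕ) : Set where
    field
      initial : s 0 ≡ 1
      bounded : ∀ r → s r ≤ n
      mono    : ∀ r → s r ≤ s (suc r)
      double  : ∀ r → s r < m → 2 * s r ≤ s (suc r)
      grow    : ∀ r → m ≤ s r → 2 * s r ≤ n → s r +[ 1 ]≤ s (suc r)

    mono-≤ : ∀ {r r′} → r ≤ r′ → s r ≤ s r′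
    mono-≤ = mono-≤′ ∘ ≤⇒≤′
      where
      mono-≤′ : ∀ {r r′} → r ≤′ r′ → s r ≤ s r′
      mono-≤′ ≤′-refl          = ≤-refl
      mono-≤′ (≤′-step r≤′r′) = ≤-trans (mono-≤′ r≤′r′) (mono _)

    positive : ∀ r → 1 ≤ s r
    positive r = subst (_≤ s r) initial (mono-≤ z≤n)

    doubling-phase : ∀ r → 2 ^ r ≤ s r ⊎ m ≤ s r
    doubling-phase zero = inj₁ (≤-reflexive (sym initial))
    doubling-phase (suc r) with doubling-phase r | s r <? m
    ... | inj₂ m≤sr    | _        = inj₂ (≤-trans m≤sr (mono r))
    ... | inj₁ 2^r≤sr  | yes sr<m = inj₁ (≤-trans (*-monoʳ-≤ 2 2^r≤sr) (double r sr<m))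
    ... | inj₁ _       | no  sr≮m = inj₂ (≤-trans (≮⇒≥ sr≮m) (mono r))

    reach : ∀ {a} → m ≤ 2 ^ a → m ≤ s a
    reach {a} m≤2^a = [ ≤-trans m≤2^a , id ]′ (doubling-phase a)

    advance : ∀ {a j} → m +[ j ]≤ s (a + j) → 2 * s (a + j) ≤ n → m +[ suc j ]≤ s (a + suc j)
    advance {a} {j} m+jb≤s small = subst₂ (λ x y → m +[ x ]≤ s y) (+-comm j 1) (sym (+-suc a j))
      (+[]≤-trans m+jb≤s (grow (a + j) (+[]≤⇒≤ m+jb≤s) small))

    linear-phase : ∀ {a} → m ≤ s a → ∀ j → m +[ j ]≤ s (a + j) ⊎ n < 2 * s (a + j)
    linear-phase {a} m≤sa zero = inj₁ (+[0]≤ (subst (λ x → m ≤ s x) (sym (+-identityʳ a)) m≤sa))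
    linear-phase {a} m≤sa (suc j) with n <? 2 * s (a + j)
    ... | yes big  = inj₂ (<-≤-trans big (*-monoʳ-≤ 2 (mono-≤ (+-monoʳ-≤ a (n≤1+n j)))))
    ... | no small with linear-phase m≤sa j
    ...   | inj₁ m+jb≤s = inj₁ (advance m+jb≤s (≮⇒≥ small))
    ...   | inj₂ big    = ⊥-elim (small big)

    strict : ∀ r → 2 * s r ≤ n → s r < s (suc r)
    strict r small with s r <? m
    ... | yes sr<m = <-≤-trans (m<m+n (s r) (≤-trans (positive r) (m≤m+n (s r) 0))) (double r sr<m)
    ... | no  sr≮m = +[1+j]≤⇒< (grow r (≮⇒≥ sr≮m) small)

    beyond-half : ∀ r → r < s r ⊎ n < 2 * s r
    beyond-half zero = inj₁ (positive 0)
    beyond-half (suc r) with n <? 2 * s r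
    ... | yes big  = inj₂ (<-≤-trans big (*-monoʳ-≤ 2 (mono r)))
    ... | no small with beyond-half r
    ...   | inj₁ r<sr = inj₁ (<-≤-trans (s≤s r<sr) (strict r (≮⇒≥ small)))
    ...   | inj₂ big  = ⊥-elim (small big)

    exceeds-half : n < 2 * s n
    exceeds-half with beyond-half n
    ... | inj₁ n<sn = ⊥-elim (<⇒≱ n<sn (bounded n))
    ... | inj₂ big  = big

  -- Move the split i + j = L towards the first sequence while the second one is past n/2:
  -- disjointness then keeps the first one below n/2, so it keeps gaining b per step.
  disjoint-growth : ∀ {n m sx sy a L} → Expanding n m sx → Expanding n m sy → m ≤ sx a → m ≤ sy a →
                    (∀ i j → i + j ≡ L → sx (a + i) + sy (a + j) ≤ n) → m + m +[ L ]≤ n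
  disjoint-growth {n} {m} {sx} {sy} {a} {L} X Y m≤sxa m≤sya disjoint =
    go 0 L refl (at-start sx m≤sxa)
    where
    module X = Expanding X
    module Y = Expanding Y

    at-start : ∀ s → m ≤ s a → m +[ 0 ]≤ s (a + 0)
    at-start s m≤sa = +[0]≤ (subst (λ x → m ≤ s x) (sym (+-identityʳ a)) m≤sa)

    combine : ∀ {i j} → i + j ≡ L → m +[ i ]≤ sx (a + i) → m +[ j ]≤ sy (a + j) → m + m +[ L ]≤ n
    combine {i} {j} i+j≡L m+ib≤sx m+jb≤sy =
      +[]≤-weakenʳ (disjoint i j i+j≡L) (subst (λ l → m + m +[ l ]≤ _) i+j≡L (+[]≤-+ m+ib≤sx m+jb≤sy))

    go : ∀ i j → i + j ≡ L → m +[ i ]≤ sx (a + i) → m + m +[ L ]≤ n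
    go i zero    i+0≡L m+ib≤sx = combine i+0≡L m+ib≤sx (at-start sy m≤sya)
    go i (suc j) i+j≡L m+ib≤sx with Y.linear-phase m≤sya (suc j)
    ... | inj₁ m+jb≤sy = combine i+j≡L m+ib≤sx m+jb≤sy
    ... | inj₂ big     = go (suc i) j (trans (sym (+-suc i j)) i+j≡L) (X.advance m+ib≤sx small)
      where
      small : 2 * sx (a + i) ≤ n
      small = m+n≤o∧o<2n⇒2m≤o (sx (a + i)) (sy (a + suc j)) (disjoint i (suc j) i+j≡L) big

-- Neighbourhoods

anyFin⁻ : ∀ {n} (f : Fin n → Bool) → anyFin f ≡ true → ∃[ i ] f i ≡ true
anyFin⁻ {suc _} f any≡true with f zero in f0
... | true  = zero , f0
... | false = let i , fi = anyFin⁻ (f ∘ suc) any≡true in suc i , fi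

anyFin⁺ : ∀ {n} (f : Fin n → Bool) {i} → f i ≡ true → anyFin f ≡ true
anyFin⁺ f {zero}  fi rewrite fi = refl
anyFin⁺ f {suc i} fi with f zero
... | true  = refl
... | false = anyFin⁺ (f ∘ suc) fi

module _ {n} (G : Graph n) where

  ∈N⁻ : ∀ {S w} → w ∈ N G S → ∃[ u ] u ∈ S × adj G u w ≡ true
  ∈N⁻ {S} {w} w∈NS
    with u , Su∧uw ← anyFin⁻ _ (trans (sym (lookup∘tabulate _ w)) ([]=⇒lookup w∈NS))
    with true ← lookup S u in Su
    = u , lookup⇒[]= u S Su , Su∧uw

  ∈N⁅v⁆⁻ : ∀ {v w} → w ∈ N G ⁅ v ⁆ → adj G v w ≡ true
  ∈N⁅v⁆⁻ {v} {w} w∈N⁅v⁆ with u , u∈⁅v⁆ , u-w ← ∈N⁻ w∈N⁅v⁆ =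
    subst (λ x → adj G x w ≡ true) (x∈⁅y⁆⇒x≡y v u∈⁅v⁆) u-w

  ∈N⁺ : ∀ {S u w} → u ∈ S → adj G u w ≡ true → w ∈ N G S
  ∈N⁺ {S} {u} {w} u∈S uw = lookup⇒[]= w (N G S)
    (trans (lookup∘tabulate _ w) (anyFin⁺ (λ v → lookup S v ∧ adj G v w) (cong₂ _∧_ ([]=⇒lookup u∈S) uw)))

∈V⁻ : ∀ {n k} {G : Graph n} (C : Cycle G k) {w} → w ∈ V C → ∃[ i ] lookup (vtx C) i ≡ w
∈V⁻ C {w} w∈VC
  with i , found ← anyFin⁻ _ (trans (sym (lookup∘tabulate _ w)) ([]=⇒lookup w∈VC))
  with yes Ci≡w ← lookup (vtx C) i Finₚ.≟ w
  = i , Ci≡w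

module _ {n} {G : Graph n} where

  ∣N∩W∣≤∣N∩W∖U∣+c*∣S∣ : ∀ (U : Subset n) c → (∀ v → ∣ N G ⁅ v ⁆ ∩ U ∣ ≤ c) →
                        ∀ S W → ∣ N G S ∩ W ∣ ≤ ∣ N G S ∩ (W ∩ ∁ U) ∣ + c * ∣ S ∣
  ∣N∩W∣≤∣N∩W∖U∣+c*∣S∣ U c few S W = begin
    ∣ N G S ∩ W ∣
      ≤⟨ p⊆q⇒∣p∣≤∣q∣ split ⟩
    ∣ N G S ∩ (W ∩ ∁ U) ∪ ⋃[ S ] (λ v → N G ⁅ v ⁆ ∩ U) ∣
      ≤⟨ ∣p∪q∣≤∣p∣+∣q∣ (N G S ∩ (W ∩ ∁ U)) _ ⟩
    ∣ N G S ∩ (W ∩ ∁ U) ∣ + ∣ ⋃[ S ] (λ v → N G ⁅ v ⁆ ∩ U) ∣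
      ≤⟨ +-monoʳ-≤ ∣ N G S ∩ (W ∩ ∁ U) ∣ (∣⋃[S]F∣≤c*∣S∣ c S _ few) ⟩
    ∣ N G S ∩ (W ∩ ∁ U) ∣ + c * ∣ S ∣
      ∎
    where
    open ≤-Reasoning
    split : N G S ∩ W ⊆ N G S ∩ (W ∩ ∁ U) ∪ ⋃[ S ] (λ v → N G ⁅ v ⁆ ∩ U)
    split {w} w∈ with w∈N , w∈W ← x∈p∩q⁻ (N G S) W w∈ with w ∈? U
    ... | no  w∉U = x∈p∪q⁺ (inj₁ (x∈p∩q⁺ (w∈N , x∈p∩q⁺ (w∈W , x∉p⇒x∈∁p w∉U))))
    ... | yes w∈U with v , v∈S , v-w ← ∈N⁻ G w∈N =
      x∈p∪q⁺ (inj₂ (x∈⋃[S]F⁺ S (λ v → N G ⁅ v ⁆ ∩ U) v∈S (x∈p∩q⁺ (∈N⁺ G (x∈⁅x⁆ v) v-w , w∈U))))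

Expands-shift : ∀ {n} {G : Graph n} {Δ β m W W′} c → Expands G Δ β m W →
                (∀ S → ∣ N G S ∩ W ∣ ≤ ∣ N G S ∩ W′ ∣ + c * ∣ S ∣) → Expands G (Δ ℚ.- ⟦ c ⟧) β m W′
Expands-shift {G = G} {Δ} {W′ = W′} c (expand , grow) fewer =
    (λ S small → Δ*s≤t+c*s⇒[Δ-c]*s≤t Δ c ∣ S ∣ ∣ N G S ∩ W′ ∣
                   (ℚₚ.≤-trans (expand S small) (⟦⟧-mono-≤ (fewer S))))
  , grow

-- Walks

infixr 5 _∷_
data Walk {n} (G : Graph n) : Fin n → Fin n → ℕ → Set where
  []  : ∀ {u} → Walk G u u 0
  _∷_ : ∀ {u v w l} → adj G u v ≡ true → Walk G v w l → Walk G u w (suc l)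

adj-sym : ∀ {n} (G : Graph n) {u v} → adj G u v ≡ true → adj G v u ≡ true
adj-sym G {u} {v} uv = trans (Graph.sym G v u) uv

module _ {n} {G : Graph n} where

  infixr 5 _++_
  _++_ : ∀ {u v w i j} → Walk G u v i → Walk G v w j → Walk G u w (i + j)
  []      ++ q = q
  (e ∷ p) ++ q = e ∷ (p ++ q)

  reverse : ∀ {u v l} → Walk G u v l → Walk G v u l
  reverse []                  = []
  reverse {l = suc l} (e ∷ p) = subst (Walk G _ _) (+-comm l 1) (reverse p ++ adj-sym G e ∷ [])

  vertex : ∀ {u v l} → Walk G u v l → ℕ → Fin n
  vertex {u = u} _       zero    = u
  vertex {u = u} []      (suc i) = u
  vertex         (_ ∷ p) (suc i) = vertex p i

  vertex-last : ∀ {u v l} (p : Walk G u v l) → vertex p l ≡ v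
  vertex-last []      = refl
  vertex-last (_ ∷ p) = vertex-last p

  vertex-adj : ∀ {u v l} (p : Walk G u v l) {i} → i < l → adj G (vertex p i) (vertex p (suc i)) ≡ true
  vertex-adj (e ∷ [])     {zero}  _         = e
  vertex-adj (e ∷ _ ∷ _)  {zero}  _         = e
  vertex-adj (_ ∷ p)      {suc i} (s≤s i<l) = vertex-adj p i<l

  take : ∀ {u v l} (p : Walk G u v l) i → i ≤ l → Walk G u (vertex p i) i
  take p       zero    _         = []
  take (e ∷ p) (suc i) (s≤s i≤l) = e ∷ take p i i≤l

  drop : ∀ {u v l} (p : Walk G u v l) i → i ≤ l → Walk G (vertex p i) v (l ∸ i)
  drop p       zero    _         = p
  drop (_ ∷ p) (suc i) (s≤s i≤l) = drop p i i≤l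

  segment : ∀ {u v l} (p : Walk G u v l) i d → i + d ≤ l → Walk G (vertex p i) (vertex p (i + d)) d
  segment p       zero    d i+d≤l       = take p d i+d≤l
  segment (_ ∷ p) (suc i) d (s≤s i+d≤l) = segment p i d i+d≤l

walk? : ∀ {n} (G : Graph n) u v l → Dec (Walk G u v l)
walk? G u v zero with u Finₚ.≟ v
... | yes refl = yes []
... | no  u≢v  = no λ { [] → u≢v refl }
walk? G u v (suc l) with Finₚ.any? (λ w → (adj G u w Boolₚ.≟ true) ×-dec walk? G w v l)
... | yes (w , e , p) = yes (e ∷ p)
... | no  ¬step       = no λ { (e ∷ p) → ¬step (_ , e , p) }

module _ {n} {G : Graph n} where

  closedWalk⇒Cycle : ∀ {u k} (C : Walk G u u k) → 3 ≤ k →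
                     (∀ {i j} → i < j → j < k → vertex C i ≢ vertex C j) → Cycle G k
  closedWalk⇒Cycle {k = suc k} C 3≤k distinct = record
    { vtx      = tabulate (vertex C ∘ toℕ)
    ; long     = 3≤k
    ; distinct = injective
    ; edges    = λ i → subst₂ (λ x y → adj G x y ≡ true)
                           (sym (lookup-vtx i)) (trans (sym (vertex-next i)) (sym (lookup-vtx (next i))))
                           (vertex-adj C (Finₚ.toℕ<n i))
    }
    where
    lookup-vtx : ∀ i → lookup (tabulate (vertex C ∘ toℕ)) i ≡ vertex C (toℕ i)
    lookup-vtx = lookup∘tabulate (vertex C ∘ toℕ)

    injective : ∀ {i j} → lookup (tabulate (vertex C ∘ toℕ)) i ≡ lookup (tabulate (vertex C ∘ toℕ)) j → i ≡ j
    injective {i} {j} Ci≡Cj with <-cmp (toℕ i) (toℕ j)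
    ... | tri< i<j _ _ = ⊥-elim (distinct i<j (Finₚ.toℕ<n j)
                                  (trans (sym (lookup-vtx i)) (trans Ci≡Cj (lookup-vtx j))))
    ... | tri≈ _ i≡j _ = Finₚ.toℕ-injective i≡j
    ... | tri> _ _ j<i = ⊥-elim (distinct j<i (Finₚ.toℕ<n i)
                                  (trans (sym (lookup-vtx j)) (trans (sym Ci≡Cj) (lookup-vtx i))))

    vertex-next : ∀ i → vertex C (toℕ (next i)) ≡ vertex C (suc (toℕ i))
    vertex-next i with m≤n⇒m<n∨m≡n (s≤s⁻¹ (Finₚ.toℕ<n i))
    ... | inj₁ i<k  = cong (vertex C) (begin
      toℕ (next i)          ≡⟨ Finₚ.toℕ-fromℕ< (m%n<n (toℕ i + 1) (suc k)) ⟩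
      (toℕ i + 1) % suc k   ≡⟨ m<n⇒m%n≡m (s≤s (≤-trans (≤-reflexive (+-comm (toℕ i) 1)) i<k)) ⟩
      toℕ i + 1             ≡⟨ +-comm (toℕ i) 1 ⟩
      suc (toℕ i)           ∎)
      where open ≡-Reasoning
    ... | inj₂ i≡k = begin
      vertex C (toℕ (next i))        ≡⟨ cong (vertex C) (Finₚ.toℕ-fromℕ< (m%n<n (toℕ i + 1) (suc k))) ⟩
      vertex C ((toℕ i + 1) % suc k) ≡⟨ cong (λ x → vertex C ((x + 1) % suc k)) i≡k ⟩
      vertex C ((k + 1) % suc k)     ≡⟨ cong (λ x → vertex C (x % suc k)) (+-comm k 1) ⟩
      vertex C (suc k % suc k)       ≡⟨ cong (vertex C) (n%n≡0 (suc k)) ⟩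
      vertex C 0                     ≡⟨ vertex-last C ⟨
      vertex C (suc k)               ≡⟨ cong (vertex C ∘ suc) i≡k ⟨
      vertex C (suc (toℕ i))         ∎
      where open ≡-Reasoning

  ∈V-closedWalk⇒Cycle⁻ : ∀ {u k} (C : Walk G u u k) (3≤k : 3 ≤ k)
                         (distinct : ∀ {i j} → i < j → j < k → vertex C i ≢ vertex C j) {w} →
                         w ∈ V (closedWalk⇒Cycle C 3≤k distinct) → ∃[ j ] j < k × vertex C j ≡ w
  ∈V-closedWalk⇒Cycle⁻ {k = suc k} C 3≤k distinct w∈V with i , Ci≡w ← ∈V⁻ (closedWalk⇒Cycle C 3≤k distinct) w∈V
    = toℕ i , Finₚ.toℕ<n i , trans (sym (lookup∘tabulate (vertex C ∘ toℕ) i)) Ci≡w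

-- Shortest odd closed walks

parity-suc : ∀ n → parity (suc n) ≡ parity n ℙ.⁻¹
parity-suc n = trans (sym (ℙₚ.⁻¹-involutive _)) (cong ℙ._⁻¹ (ℙₚ.suc-homo-⁻¹ n))

parity-+-suc : ∀ {a b} → parity a ≡ parity b → parity (a + suc b) ≡ 1ℙ
parity-+-suc {a} {b} same = begin
  parity (a + suc b)                 ≡⟨ ℙₚ.+-homo-+ a (suc b) ⟩
  parity a ℙ.+ parity (suc b)        ≡⟨ cong₂ ℙ._+_ same (parity-suc b) ⟩
  parity b ℙ.+ parity b ℙ.⁻¹         ≡⟨ ℙₚ.p+p⁻¹≡1ℙ (parity b) ⟩
  1ℙ                                 ∎
  where open ≡-Reasoning

parity≡1ℙ⇒Odd : ∀ k → parity k ≡ 1ℙ → Odd k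
parity≡1ℙ⇒Odd 1             _    = 0 , refl
parity≡1ℙ⇒Odd (suc (suc k)) odd with j , refl ← parity≡1ℙ⇒Odd k odd =
  suc j , cong (λ x → suc (suc x)) (sym (+-suc j (j + 0)))

parity-complement : ∀ x y z → parity (x + y) ≡ 1ℙ → parity (y + z) ≡ 0ℙ → parity (x + z) ≡ 1ℙ
parity-complement x y z
  rewrite ℙₚ.+-homo-+ x y | ℙₚ.+-homo-+ y z | ℙₚ.+-homo-+ x z = cases (parity x) (parity y) (parity z)
  where
  cases : ∀ p q r → p ℙ.+ q ≡ 1ℙ → q ℙ.+ r ≡ 0ℙ → p ℙ.+ r ≡ 1ℙ
  cases 0ℙ 1ℙ 1ℙ _ _ = refl
  cases 1ℙ 0ℙ 0ℙ _ _ = refl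
  cases 0ℙ 0ℙ _  () _
  cases 1ℙ 1ℙ _  () _
  cases 0ℙ 1ℙ 0ℙ _  ()
  cases 1ℙ 0ℙ 1ℙ _  ()

oddClosedWalk-3≤ : ∀ {n} {G : Graph n} {u k} → Walk G u u k → parity k ≡ 1ℙ → 3 ≤ k
oddClosedWalk-3≤ {G = G} {u} (uu ∷ []) _ with () ← trans (sym uu) (irrefl G u)
oddClosedWalk-3≤ {k = suc (suc (suc k))} _ _ = s≤s (s≤s (s≤s z≤n))

record ShortestOddClosedWalk {n} (G : Graph n) (k : ℕ) : Set where
  field
    {start}  : Fin n
    walk     : Walk G start start k
    odd      : parity k ≡ 1ℙ
    shortest : ∀ {x ℓ} → Walk G x x ℓ → parity ℓ ≡ 1ℙ → k ≤ ℓ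

  -- An even detour cannot be shorter than the arc it bypasses, since going around the rest of
  -- the walk would then close a shorter odd walk.
  detour : ∀ {i d ℓ} → i + d ≤ k → Walk G (vertex walk i) (vertex walk (i + d)) ℓ → d ≤ ℓ ⊎ k ≤ d + ℓ
  detour {i} {d} {ℓ} i+d≤k P with parity (d + ℓ) in d+ℓ-parity
  ... | 1ℙ = inj₂ (shortest (segment walk i d i+d≤k ++ reverse P) d+ℓ-parity)
  ... | 0ℙ = inj₁ (+-cancelʳ-≤ (e + i) d ℓ (begin
    d + (e + i)  ≡⟨ +-comm d (e + i) ⟩
    e + i + d    ≡⟨ e+i+d≡k ⟩
    k            ≤⟨ shortest around around-odd ⟩
    ℓ + (e + i)  ∎))
    where
    open ≤-Reasoning
    e = k ∸ (i + d)
    e+i+d≡k : e + i + d ≡ k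
    e+i+d≡k = trans (+-assoc e i d) (m∸n+n≡m i+d≤k)
    around : Walk G (vertex walk i) (vertex walk i) (ℓ + (e + i))
    around = P ++ drop walk (i + d) i+d≤k ++ take walk i (≤-trans (m≤m+n i d) i+d≤k)
    around-odd : parity (ℓ + (e + i)) ≡ 1ℙ
    around-odd = subst (λ x → parity x ≡ 1ℙ) (+-comm (e + i) ℓ)
      (parity-complement (e + i) d ℓ (subst (λ x → parity x ≡ 1ℙ) (sym e+i+d≡k) odd) d+ℓ-parity)

  vertex-injective : ∀ {i j} → i < j → j < k → vertex walk i ≢ vertex walk j
  vertex-injective {i} {j} i<j j<k Ci≡Cj with detour (subst (_≤ k) (sym i+d≡j) (<⇒≤ j<k)) stay
    where
    d = j ∸ i
    i+d≡j : i + d ≡ j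
    i+d≡j = m+[n∸m]≡n (<⇒≤ i<j)
    stay : Walk G (vertex walk i) (vertex walk (i + d)) 0
    stay = subst (λ x → Walk G (vertex walk i) (vertex walk x) 0) (sym i+d≡j)
                 (subst (λ y → Walk G (vertex walk i) y 0) Ci≡Cj [])
  ... | inj₁ d≤0   = <⇒≱ (m<n⇒0<n∸m i<j) d≤0
  ... | inj₂ k≤d+0 = <⇒≱ j<k (≤-trans k≤d+0 (≤-trans (≤-reflexive (+-identityʳ _)) (m∸n≤m j i)))

  cycle : Cycle G k
  cycle = closedWalk⇒Cycle walk (oddClosedWalk-3≤ walk odd) vertex-injective

  window : ℕ → List ℕ
  window i = i ∷ 1 + i ∷ 2 + i ∷ k ∸ 2 ∷ k ∸ 1 ∷ []

  neighbour-positions : ∀ {v i j} → i ≤ j → j < k →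
                        adj G (vertex walk i) v ≡ true → adj G v (vertex walk j) ≡ true → j ∈ₗ window i
  neighbour-positions {v} {i} {j} i≤j j<k Ci-v v-Cj with detour (subst (_≤ k) (sym i+d≡j) (<⇒≤ j<k)) hop
    where
    i+d≡j : i + (j ∸ i) ≡ j
    i+d≡j = m+[n∸m]≡n i≤j
    hop : Walk G (vertex walk i) (vertex walk (i + (j ∸ i))) 2
    hop = subst (λ x → Walk G (vertex walk i) (vertex walk x) 2) (sym i+d≡j) (Ci-v ∷ v-Cj ∷ [])
  ... | inj₁ d≤2   = near-start (j ∸ i) d≤2 (m+[n∸m]≡n i≤j)
    where
    near-start : ∀ d → d ≤ 2 → i + d ≡ j → j ∈ₗ window i
    near-start 0 _ i+d≡j = here (trans (sym i+d≡j) (+-identityʳ i))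
    near-start 1 _ i+d≡j = there (here (trans (sym i+d≡j) (+-comm i 1)))
    near-start 2 _ i+d≡j = there (there (here (trans (sym i+d≡j) (+-comm i 2))))
    near-start (suc (suc (suc _))) (s≤s (s≤s ()))
  ... | inj₂ k≤d+2 with m≤n⇒m<n∨m≡n j<k
  ...   | inj₂ 1+j≡k = there (there (there (there (here (cong (_∸ 1) 1+j≡k)))))
  ...   | inj₁ 1+j<k = there (there (there (here (cong (_∸ 2) 2+j≡k))))
    where
    2+j≡k : 2 + j ≡ k
    2+j≡k = ≤-antisym 1+j<k (≤-trans k≤d+2 (≤-trans (+-monoˡ-≤ 2 (m∸n≤m j i)) (≤-reflexive (+-comm j 2))))

  on-cycle : ∀ {v w} → w ∈ N G ⁅ v ⁆ ∩ V cycle →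
             ∃[ j ] j < k × adj G v (vertex walk j) ≡ true × vertex walk j ≡ w
  on-cycle {v} w∈ with w∈N , w∈V ← x∈p∩q⁻ (N G ⁅ v ⁆) (V cycle) w∈
              with j , j<k , Cj≡w ← ∈V-closedWalk⇒Cycle⁻ walk (oddClosedWalk-3≤ walk odd) vertex-injective w∈V
    = j , j<k , subst (λ x → adj G v x ≡ true) (sym Cj≡w) (∈N⁅v⁆⁻ G w∈N) , Cj≡w

  adjacent-on-walk? : ∀ v → Decidable (λ i → i < k × adj G v (vertex walk i) ≡ true)
  adjacent-on-walk? v i = (i <? k) ×-dec (adj G v (vertex walk i) Boolₚ.≟ true)

  ∣N⁅v⁆∩V∣≤5 : ∀ v → ∣ N G ⁅ v ⁆ ∩ V cycle ∣ ≤ 5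
  ∣N⁅v⁆∩V∣≤5 v with anyUpTo? (λ i → adj G v (vertex walk i) Boolₚ.≟ true) k
  ... | no none = ≤-trans (p⊆q⇒∣p∣≤∣q∣ ⊆∅) (≤-trans (∣fromList∣≤length {n} []) z≤n)
    where
    ⊆∅ : N G ⁅ v ⁆ ∩ V cycle ⊆ fromList []
    ⊆∅ w∈ with j , j<k , v-Cj , _ ← on-cycle w∈ = ⊥-elim (none (j , j<k , v-Cj))
  ... | yes (j , j<k , v-Cj) with i , (i<k , v-Ci) , below ← least (adjacent-on-walk? v) (j<k , v-Cj) =
        ≤-trans (p⊆q⇒∣p∣≤∣q∣ ⊆window) (∣fromList∣≤length (map (vertex walk) (window i)))
    where
    ⊆window : N G ⁅ v ⁆ ∩ V cycle ⊆ fromList (map (vertex walk) (window i))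
    ⊆window w∈ with j , j<k , v-Cj , Cj≡w ← on-cycle w∈ =
      x∈fromList⁺ (subst (_∈ₗ map (vertex walk) (window i)) Cj≡w (∈-map⁺ (vertex walk)
        (neighbour-positions (≮⇒≥ λ j<i → below j<i (j<k , v-Cj)) j<k (adj-sym G v-Ci) v-Cj)))

  antipode-far : ∀ {h ℓ} → k ≡ suc (2 * h) → Walk G start (vertex walk h) ℓ → h ≤ ℓ
  antipode-far {h} {ℓ} k≡1+2h P with detour {0} {h} (subst (h ≤_) (sym k≡1+2h) (m≤n⇒m≤1+n (m≤m+n h (h + 0)))) P
  ... | inj₁ h≤ℓ   = h≤ℓ
  ... | inj₂ k≤h+ℓ = +-cancelˡ-≤ h h ℓ (begin
    h + h        ≡⟨ cong (_+_ h) (+-identityʳ h) ⟨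
    2 * h        ≤⟨ n≤1+n (2 * h) ⟩
    suc (2 * h)  ≡⟨ k≡1+2h ⟨
    k            ≤⟨ k≤h+ℓ ⟩
    h + ℓ        ∎)
    where open ≤-Reasoning

  common-neighbour⇒k≤3 : ∀ {w} → w ∈ N G ⁅ start ⁆ → w ∈ N G ⁅ vertex walk 1 ⁆ → k ≤ 3
  common-neighbour⇒k≤3 w∈N₀ w∈N₁ =
    shortest (∈N⁅v⁆⁻ G w∈N₀ ∷ adj-sym G (∈N⁅v⁆⁻ G w∈N₁) ∷ adj-sym G C₀-C₁ ∷ []) refl
    where
    C₀-C₁ : adj G start (vertex walk 1) ≡ true
    C₀-C₁ = vertex-adj walk {0} (≤-trans (s≤s z≤n) (oddClosedWalk-3≤ walk odd))

-- Balls and connectivity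

Ball : ∀ {n} → Graph n → Fin n → ℕ → Subset n
Ball G x zero    = ⁅ x ⁆
Ball G x (suc r) = N G (Ball G x r) ∪ Ball G x r

∈Ball⇒walk : ∀ {n} (G : Graph n) {x w} r → w ∈ Ball G x r → ∃[ ℓ ] ℓ ≤ r × Walk G x w ℓ
∈Ball⇒walk G zero w∈⁅x⁆ rewrite x∈⁅y⁆⇒x≡y _ w∈⁅x⁆ = 0 , z≤n , []
∈Ball⇒walk G {x} (suc r) w∈ with x∈p∪q⁻ (N G (Ball G x r)) (Ball G x r) w∈
... | inj₂ w∈Bʳ with ℓ , ℓ≤r , p ← ∈Ball⇒walk G r w∈Bʳ = ℓ , m≤n⇒m≤1+n ℓ≤r , p
... | inj₁ w∈NBʳ with u , u∈Bʳ , u-w ← ∈N⁻ G w∈NBʳ with ℓ , ℓ≤r , p ← ∈Ball⇒walk G r u∈Bʳ =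
  ℓ + 1 , subst (_≤ suc r) (+-comm 1 ℓ) (s≤s ℓ≤r) , p ++ u-w ∷ []

connected : ∀ {n} (G : Graph n) → (∀ x → n < 2 * ∣ Ball G x n ∣) → ∀ x y → ∃[ ℓ ] Walk G x y ℓ
connected {n} G more-than-half x y with Finₚ.any? (λ w → (w ∈? Ball G x n) ×-dec (w ∈? Ball G y n))
... | yes (w , w∈Bx , w∈By) with ℓ₁ , _ , p ← ∈Ball⇒walk G n w∈Bx with ℓ₂ , _ , q ← ∈Ball⇒walk G n w∈By =
  ℓ₁ + ℓ₂ , p ++ reverse q
... | no none = ⊥-elim (<⇒≱ (more-than-half x)
  (m+n≤o∧o<2n⇒2m≤o ∣ Ball G x n ∣ ∣ Ball G y n ∣
    (disjoint⇒∣p∣+∣q∣≤n (Ball G x n) (Ball G y n) (λ w∈Bx w∈By → none (_ , w∈Bx , w∈By)))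
    (more-than-half y)))

nonBipartite⇒oddClosedWalk : ∀ {n} {G : Graph n} → (∀ x y → ∃[ ℓ ] Walk G x y ℓ) → ¬ Bipartite G →
                             ∃[ x ] ∃[ ℓ ] Walk G x x ℓ × parity ℓ ≡ 1ℙ
nonBipartite⇒oddClosedWalk {zero}      _    nonBipartite = ⊥-elim (nonBipartite ((λ ()) , λ ()))
nonBipartite⇒oddClosedWalk {suc _} {G} path nonBipartite = monochromatic-edge⇒odd
  (Finₚ.any? λ u → Finₚ.any? λ v → (adj G u v Boolₚ.≟ true) ×-dec (colour u Boolₚ.≟ colour v))
  where
  isOdd : Parity → Bool
  isOdd 0ℙ = false
  isOdd 1ℙ = true

  isOdd-injective : ∀ {p q} → isOdd p ≡ isOdd q → p ≡ q
  isOdd-injective {0ℙ} {0ℙ} _ = refl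
  isOdd-injective {1ℙ} {1ℙ} _ = refl
  isOdd-injective {0ℙ} {1ℙ} ()
  isOdd-injective {1ℙ} {0ℙ} ()

  colour : Fin _ → Bool
  colour v = isOdd (parity (proj₁ (path zero v)))

  monochromatic-edge⇒odd : Dec (∃[ u ] ∃[ v ] adj G u v ≡ true × colour u ≡ colour v) →
                           ∃[ x ] ∃[ ℓ ] Walk G x x ℓ × parity ℓ ≡ 1ℙ
  monochromatic-edge⇒odd (no none) = ⊥-elim (nonBipartite (colour , λ u v u-v same → none (u , v , u-v , same)))
  monochromatic-edge⇒odd (yes (u , v , u-v , same)) with ℓ₁ , p ← path zero u with ℓ₂ , q ← path zero v =
    zero , ℓ₁ + suc ℓ₂ , p ++ u-v ∷ reverse q , parity-+-suc {ℓ₁} {ℓ₂} (isOdd-injective same)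

oddClosedWalk? : ∀ {n} (G : Graph n) → Decidable (λ ℓ → parity ℓ ≡ 1ℙ × ∃[ x ] Walk G x x ℓ)
oddClosedWalk? G ℓ = (parity ℓ ℙₚ.≟ 1ℙ) ×-dec Finₚ.any? (λ x → walk? G x x ℓ)

oddClosedWalk⇒shortest : ∀ {n} {G : Graph n} → ∃[ x ] ∃[ ℓ ] Walk G x x ℓ × parity ℓ ≡ 1ℙ →
                         ∃[ k ] ShortestOddClosedWalk G k
oddClosedWalk⇒shortest {G = G} (x , ℓ , C , odd)
  with k , (k-odd , _ , C′) , below ← least (oddClosedWalk? G) (odd , x , C) =
  k , record { walk = C′ ; odd = k-odd ; shortest = λ W ℓ-odd → ≮⇒≥ λ ℓ<k → below ℓ<k (ℓ-odd , _ , W) }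

-- Expanding graphs

module _ {β m} (b>0 : 0ℚ ℚ.< β ℚ.* ⟦ m ⟧) where

  open Steps (β ℚ.* ⟦ m ⟧) b>0
  open +-*-Solver using (solve; _:+_; _:-_; _:*_; _:=_; con)

  cycleBound-intro : ∀ {k n c} → 2 ^ c ≤ m ^ 16 → 0 +[ k ∸ c ]≤ 4 * n → CycleBound k m n β
  cycleBound-intro {k} {n} {c} 2^c≤m^16 (+[]≤⁺ [k-c]b≤4n) x x*b≡4n =
    ≤log₂-intro ((⟦ k ⟧ ℚ.- x) ℚ.* (ℤ.+ 1 / 16)) 16 c m (begin
      (⟦ k ⟧ ℚ.- x) ℚ.* (ℤ.+ 1 / 16) ℚ.* ⟦ 16 ⟧
        ≡⟨ solve 2 (λ K X → (K :- X) :* con (ℤ.+ 1 / 16) :* con ⟦ 16 ⟧ := K :- X) refl ⟦ k ⟧ x ⟩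
      ⟦ k ⟧ ℚ.- x
        ≤⟨ ℚₚ.+-monoˡ-≤ (ℚ.- x) k≤c+x ⟩
      ⟦ c ⟧ ℚ.+ x ℚ.- x
        ≡⟨ solve 2 (λ C X → C :+ X :- X := C) refl ⟦ c ⟧ x ⟩
      ⟦ c ⟧
        ∎) 2^c≤m^16
    where
    open ℚₚ.≤-Reasoning
    k-c≤x : ⟦ k ∸ c ⟧ ℚ.≤ x
    k-c≤x = ℚₚ.*-cancelʳ-≤-pos (β ℚ.* ⟦ m ⟧) {{ℚ.positive b>0}} (begin
      ⟦ k ∸ c ⟧ ℚ.* (β ℚ.* ⟦ m ⟧)         ≡⟨ ℚₚ.+-identityˡ _ ⟨
      0ℚ ℚ.+ ⟦ k ∸ c ⟧ ℚ.* (β ℚ.* ⟦ m ⟧)  ≤⟨ [k-c]b≤4n ⟩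
      ⟦ 4 * n ⟧                           ≡⟨ x*b≡4n ⟨
      x ℚ.* (β ℚ.* ⟦ m ⟧)                 ∎)
    k≤c+x : ⟦ k ⟧ ℚ.≤ ⟦ c ⟧ ℚ.+ x
    k≤c+x = begin
      ⟦ k ⟧               ≤⟨ ⟦⟧-mono-≤ (m≤n+m∸n k c) ⟩
      ⟦ c + (k ∸ c) ⟧     ≡⟨ ⟦⟧-homo-+ c (k ∸ c) ⟩
      ⟦ c ⟧ ℚ.+ ⟦ k ∸ c ⟧  ≤⟨ ℚₚ.+-monoʳ-≤ ⟦ c ⟧ k-c≤x ⟩
      ⟦ c ⟧ ℚ.+ x          ∎

module Expansion {n} {G : Graph n} {Δ β m W} (E : Expands G Δ β m W)
                 (1≤m : 1 ≤ m) (β>0 : 0ℚ ℚ.< β) (2≤Δ : ⟦ 2 ⟧ ℚ.≤ Δ) where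

  b>0 : 0ℚ ℚ.< β ℚ.* ⟦ m ⟧
  b>0 = β*⟦m⟧-pos 1≤m β>0

  open Steps (β ℚ.* ⟦ m ⟧) b>0
  open Growth (β ℚ.* ⟦ m ⟧) b>0

  ball : Fin n → ℕ → ℕ
  ball x r = ∣ Ball G x r ∣

  balls-expand : ∀ x → Expanding n m (ball x)
  balls-expand x = record
    { initial = ∣⁅x⁆∣≡1 x
    ; bounded = λ r → ∣p∣≤n (Ball G x r)
    ; mono    = λ r → p⊆q⇒∣p∣≤∣q∣ (q⊆p∪q (N G (Ball G x r)) (Ball G x r))
    ; double  = λ r small →
        ≤-trans (⟦c⟧≤Δ⇒c*s≤t 2 {∣ Ball G x r ∣} {∣ N G (Ball G x r) ∩ W ∣} 2≤Δ (proj₁ E (Ball G x r) small))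
                (p⊆q⇒∣p∣≤∣q∣ (λ w∈ → x∈p∪q⁺ (inj₁ (proj₁ (x∈p∩q⁻ (N G (Ball G x r)) W w∈)))))
    ; grow    = λ r m≤ small → +[1]≤-intro (proj₂ E (Ball G x r) m≤ small)
    }

  module LengthBound {k h} (C : ShortestOddClosedWalk G k) (k≡1+2h : k ≡ suc (2 * h)) where

    open ShortestOddClosedWalk C

    far-balls-disjoint : ∀ {r r′} → r + r′ < h → ball start r + ball (vertex walk h) r′ ≤ n
    far-balls-disjoint {r} {r′} r+r′<h =
      disjoint⇒∣p∣+∣q∣≤n (Ball G start r) (Ball G (vertex walk h) r′) λ w∈Bu w∈By →
        let ℓ₁ , ℓ₁≤r  , p = ∈Ball⇒walk G r w∈Bu
            ℓ₂ , ℓ₂≤r′ , q = ∈Ball⇒walk G r′ w∈By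
        in <⇒≱ r+r′<h (≤-trans (antipode-far k≡1+2h (p ++ reverse q)) (+-mono-≤ ℓ₁≤r ℓ₂≤r′))

    two-balls : ∀ a L → m ≤ 2 ^ a → 2 * a + L < h → m + m +[ L ]≤ n
    two-balls a L m≤2^a 2a+L<h =
      disjoint-growth {a = a} (balls-expand start) (balls-expand (vertex walk h))
        (Expanding.reach (balls-expand start) {a} m≤2^a)
        (Expanding.reach (balls-expand (vertex walk h)) {a} m≤2^a)
        λ i j i+j≡L → far-balls-disjoint {a + i} {a + j}
                        (subst (_< h) (sym (trans (regroup a i j) (cong (_+_ (2 * a)) i+j≡L))) 2a+L<h)
      where
      regroup : ∀ a i j → (a + i) + (a + j) ≡ 2 * a + (i + j)
      regroup = solve-∀

    bound-m≤2^a : ∀ {a} → m ≤ 2 ^ a → 0 +[ k ∸ (4 * a + 3) ]≤ 4 * n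
    bound-m≤2^a {a} m≤2^a with 2 * a <? h
    ... | no 2a≮h = +[]≤-monoʲ (≤-reflexive (m≤n⇒m∸n≡0 k≤4a+3)) (+[0]≤ z≤n)
      where
      k≤4a+3 : k ≤ 4 * a + 3
      k≤4a+3 = begin
        k                  ≡⟨ k≡1+2h ⟩
        suc (2 * h)        ≤⟨ s≤s (*-monoʳ-≤ 2 (≮⇒≥ 2a≮h)) ⟩
        suc (2 * (2 * a))  ≡⟨ cong suc (*-assoc 2 2 a) ⟨
        1 + 4 * a          ≤⟨ +-monoˡ-≤ (4 * a) (≤ᵇ⇒≤ 1 3 _) ⟩
        3 + 4 * a          ≡⟨ +-comm 3 (4 * a) ⟩
        4 * a + 3          ∎
        where open ≤-Reasoning
    ... | yes 2a<h = +[]≤-monoʲ k∸c≤4L (+[]≤-scale 4 (+[]≤-trans (+[0]≤ z≤n) (two-balls a L m≤2^a 2a+L<h)))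
      where
      L = h ∸ suc (2 * a)
      h≡1+2a+L : suc (2 * a) + L ≡ h
      h≡1+2a+L = m+[n∸m]≡n 2a<h
      2a+L<h : 2 * a + L < h
      2a+L<h = ≤-reflexive h≡1+2a+L
      unfold : ∀ a L → suc (2 * (suc (2 * a) + L)) ≡ (4 * a + 3) + 2 * L
      unfold = solve-∀
      k∸c≤4L : k ∸ (4 * a + 3) ≤ 4 * L
      k∸c≤4L = begin
        k ∸ (4 * a + 3)
          ≡⟨ cong (_∸ (4 * a + 3)) (trans k≡1+2h (cong (λ h → suc (2 * h)) (sym h≡1+2a+L))) ⟩
        suc (2 * (suc (2 * a) + L)) ∸ (4 * a + 3)
          ≡⟨ cong (_∸ (4 * a + 3)) (unfold a L) ⟩
        (4 * a + 3) + 2 * L ∸ (4 * a + 3)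
          ≡⟨ m+n∸m≡n (4 * a + 3) (2 * L) ⟩
        2 * L
          ≤⟨ *-monoˡ-≤ L (≤ᵇ⇒≤ 2 4 _) ⟩
        4 * L
          ∎
        where open ≤-Reasoning

    1≤h : 1 ≤ h
    1≤h = *-cancelˡ-≤ 2 (s≤s⁻¹ (subst (3 ≤_) k≡1+2h (oddClosedWalk-3≤ walk odd)))

    2≤n : 2 ≤ n
    2≤n = ≤-trans (≤ᵇ⇒≤ 2 3 _) (≤-trans (oddClosedWalk-3≤ walk odd) (Finₚ.injective⇒≤ (distinct cycle)))

    b≤∣N⁅v⁆∣ : m ≤ 1 → ∀ v → 0 +[ 1 ]≤ ∣ N G ⁅ v ⁆ ∣
    b≤∣N⁅v⁆∣ m≤1 v = +[]≤-cancelˡ {r = 1} (+[]≤-weakenʳ ∣N⁅v⁆∪⁅v⁆∣≤1+∣N⁅v⁆∣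
      (subst (_+[ 1 ]≤ ball v 1) initial
        (grow 0 (subst (m ≤_) (sym initial) m≤1) (subst (λ s → 2 * s ≤ n) (sym initial) 2≤n))))
      where
      open Expanding (balls-expand v) using (initial; grow)
      ∣N⁅v⁆∪⁅v⁆∣≤1+∣N⁅v⁆∣ : ∣ N G ⁅ v ⁆ ∪ ⁅ v ⁆ ∣ ≤ 1 + ∣ N G ⁅ v ⁆ ∣
      ∣N⁅v⁆∪⁅v⁆∣≤1+∣N⁅v⁆∣ = ≤-trans (∣p∪q∣≤∣p∣+∣q∣ (N G ⁅ v ⁆) ⁅ v ⁆)
        (≤-reflexive (trans (cong (_+_ ∣ N G ⁅ v ⁆ ∣) (∣⁅x⁆∣≡1 v)) (+-comm ∣ N G ⁅ v ⁆ ∣ 1)))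

    bound-m≤1 : m ≤ 1 → 0 +[ k ]≤ 4 * n
    bound-m≤1 m≤1 with m≤n⇒m<n∨m≡n 1≤h
    ... | inj₂ 1≡h = subst (λ k → 0 +[ k ]≤ 4 * n) (sym k≡3) 3b≤4n
      where
      k≡3 : k ≡ 3
      k≡3 = trans k≡1+2h (cong (λ h → suc (2 * h)) (sym 1≡h))
      3b≤4n : 0 +[ 3 ]≤ 4 * n
      3b≤4n = +[]≤-weakenʳ (*-monoˡ-≤ n (≤ᵇ⇒≤ 3 4 _))
                (+[]≤-scale 3 (+[]≤-weakenʳ (∣p∣≤n (N G ⁅ start ⁆)) (b≤∣N⁅v⁆∣ m≤1 start)))
    ... | inj₁ 1<h =
      +[]≤-monoʲ k≤2[h∸1+2] (+[]≤-weakenʳ (≤-reflexive (2*[n+n]≡4*n n)) (+[]≤-scale 2 (+[]≤-+ [h∸1]b≤n 2b≤n)))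
      where
      [h∸1]b≤n : 0 +[ h ∸ 1 ]≤ n
      [h∸1]b≤n = +[]≤-trans (+[0]≤ z≤n) (two-balls 0 (h ∸ 1) m≤1 (∸-monoʳ-< {h} {1} {0} (s≤s z≤n) 1≤h))
      2b≤n : 0 +[ 2 ]≤ n
      2b≤n = +[]≤-weakenʳ (disjoint⇒∣p∣+∣q∣≤n (N G ⁅ start ⁆) (N G ⁅ vertex walk 1 ⁆) no-common-neighbour)
               (+[]≤-+ (b≤∣N⁅v⁆∣ m≤1 start) (b≤∣N⁅v⁆∣ m≤1 (vertex walk 1)))
        where
        3<k : 3 < k
        3<k = subst (3 <_) (sym k≡1+2h) (s≤s (≤-trans (≤ᵇ⇒≤ 3 4 _) (*-monoʳ-≤ 2 1<h)))
        no-common-neighbour : ∀ {w} → w ∈ N G ⁅ start ⁆ → w ∉ N G ⁅ vertex walk 1 ⁆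
        no-common-neighbour w∈N₀ w∈N₁ = <⇒≱ 3<k (common-neighbour⇒k≤3 w∈N₀ w∈N₁)
      2*[n+n]≡4*n : ∀ n → 2 * (n + n) ≡ 4 * n
      2*[n+n]≡4*n = solve-∀
      k≤2[h∸1+2] : k ≤ 2 * (h ∸ 1 + 2)
      k≤2[h∸1+2] = begin
        k                  ≡⟨ k≡1+2h ⟩
        suc (2 * h)        ≤⟨ n≤1+n _ ⟩
        2 + 2 * h          ≡⟨ *-suc 2 h ⟨
        2 * suc h          ≡⟨ cong (λ x → 2 * suc x) (m∸n+n≡m 1≤h) ⟨
        2 * suc (h ∸ 1 + 1) ≡⟨ cong (2 *_) (+-suc (h ∸ 1) 1) ⟨
        2 * (h ∸ 1 + 2)    ∎
        where open ≤-Reasoning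

    cycle-length-bound : CycleBound k m n β
    cycle-length-bound with m ≤? 1
    ... | yes m≤1 = cycleBound-intro {β} {m} b>0 {k} {n} {0} (^-monoˡ-≤ 16 1≤m) (bound-m≤1 m≤1)
    ... | no  m≰1 with a , m≤2^a , 2^a<2m ← power-of-2-between m 1≤m =
      cycleBound-intro {β} {m} b>0 {k} {n} {4 * a + 3} (2^[4a+3]≤m^16 {a} {m} 1≤a 2^a≤m^2) (bound-m≤2^a {a} m≤2^a)
      where
      1≤a : 1 ≤ a
      1≤a = ≮⇒≥ λ a<1 → m≰1 (subst (λ a → m ≤ 2 ^ a) (n<1⇒n≡0 a<1) m≤2^a)
      2^a≤m^2 : 2 ^ a ≤ m ^ 2
      2^a≤m^2 = begin
        2 ^ a  ≤⟨ <⇒≤ 2^a<2m ⟩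
        2 * m  ≤⟨ *-monoˡ-≤ m (≰⇒> m≰1) ⟩
        m * m  ≡⟨ cong (m *_) (*-identityʳ m) ⟨
        m ^ 2  ∎
        where open ≤-Reasoning

  G-connected : ∀ x y → ∃[ ℓ ] Walk G x y ℓ
  G-connected = connected G (λ x → Expanding.exceeds-half (balls-expand x))

open import Data.Integer using (+_)

lemma2p10 : (n : ℕ) (G : Graph n) (Δ β : ℚ) (m : ℕ) (W : Subset n) →
    1 ℕ.≤ m → ℚ.0ℚ ℚ.< β → (+ 2 / 1) ℚ.≤ Δ →
    ¬ Bipartite G → Expands G Δ β m W →
    Σ ℕ λ k → Σ (Cycle G k) λ C →
      Odd k × CycleBound k m n β × Expands G (Δ ℚ.- (+ 5 / 1)) β m (W ∩ ∁ (V C))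
lemma2p10 n G Δ β m W 1≤m β>0 2≤Δ nonBipartite E
  with k , C ← oddClosedWalk⇒shortest (nonBipartite⇒oddClosedWalk (Expansion.G-connected E 1≤m β>0 2≤Δ) nonBipartite)
  with h , k≡1+2h ← parity≡1ℙ⇒Odd k (ShortestOddClosedWalk.odd C) =
  k , cycle , (h , k≡1+2h) , cycle-length-bound ,
  Expands-shift {G = G} {Δ} {β} {m} {W} {W ∩ ∁ (V cycle)} 5 E
    (λ S → ∣N∩W∣≤∣N∩W∖U∣+c*∣S∣ {G = G} (V cycle) 5 ∣N⁅v⁆∩V∣≤5 S W)
  where
  open Expansion E 1≤m β>0 2≤Δ
  open ShortestOddClosedWalk C
  open LengthBound {h = h} C k≡1+2h
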